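{- Let $G$ be a graph, $S\subseteq V(G)$, and let $C$ be a connected component of $G$ that admits a proper $2$-coloring with colors white and black; fix such a coloring. Let $G'$ be obtained from $G$ by replacing $C$ with a star (with a new center vertex) whose ray vertices are exactly the vertices of $C\cap S$, and then subdividing each star edge whose ray vertex is black in the fixed coloring. Then $B_G(S)=B_{G'}(S)$.
   Context: For a graph $G$ and $S\subseteq V(G)$, $B_G(S)$ is the set of all subsets $S'\subseteq S$ such that there is a proper $2$-coloring of $G$ in which all vertices of $S'$ receive one color and all vertices of $S\setminus S'$ receive the other color. (If $G$ is not bipartite, $B_G(S)=\emptyset$.) -}

module Defs where

open import Data.Bool using (Bool; true; false; not)
open import Data.Empty using (⊥)
open import Data.Unit using (⊤)
open import Data.Product using (Σ; ∃; ∃-syntax; _×_; _,_)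
open import Data.Nat using (ℕ)
open import Data.Fin using (Fin)
open import Data.Fin.Subset using (Subset; _∈_)
import Data.Fin as F
open import Relation.Nullary using (¬_)
open import Relation.Nullary.Decidable using (⌊_⌋)
open import Relation.Binary.PropositionalEquality using (_≡_; _≢_)

-- A (simple) graph on a vertex type V is given by a Bool-valued adjacency
-- function (symmetry / irreflexivity are imposed as hypotheses where needed).
-- Subsets of V are predicates V → Set.

Proper : {V : Set} → (V → V → Bool) → (V → Bool) → Set
Proper {V} adj c = ∀ (u v : V) → adj u v ≡ true → c u ≢ c v

-- S' ∈ B_G(S): some proper 2-colouring gives all of S' one colour b
-- and all of S ∖ S' the other colour (not b).
InB : {V : Set} → (V → V → Bool) → (S S' : V → Set) → Set
InB {V} adj S S' =
  Σ (V → Bool) λ c → Σ Bool λ b →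
    Proper adj c
    × (∀ v → S v → S' v → c v ≡ b)
    × (∀ v → S v → ¬ S' v → c v ≡ not b)

data Reach {V : Set} (adj : V → V → Bool) (a : V) : V → Set where
  here : Reach adj a a
  step : ∀ {u v} → Reach adj a u → adj u v ≡ true → Reach adj a v

-- Construction of G' from G = (Fin n, adj), S, the component C = {v | Reach adj c₀ v},
-- and a colouring col of C (white = true, black = false).
module Star (n : ℕ) (adj : Fin n → Fin n → Bool) (S : Subset n)
            (c₀ : Fin n) (col : Fin n → Bool) where

  C : Fin n → Set
  C v = Reach adj c₀ v

  data V' : Set where
    old    : (v : Fin n) → ¬ C v → V'
    ray    : (v : Fin n) → C v → v ∈ S → V'
    center : V'
    sub    : (v : Fin n) → C v → v ∈ S → col v ≡ false → V'
                                                         -- subdivision vertex of the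
                                                         -- edge centre–v, v black

  adj' : V' → V' → Bool
  adj' (old u _) (old v _) = adj u v
  adj' (ray v _ _) center = col v
  adj' center (ray v _ _) = col v
  adj' (ray v _ _) (sub w _ _ _) = ⌊ v F.≟ w ⌋
  adj' (sub w _ _ _) (ray v _ _) = ⌊ v F.≟ w ⌋
  adj' center (sub _ _ _ _) = true
  adj' (sub _ _ _ _) center = true
  adj' _ _ = false

  lift : Subset n → V' → Set
  lift T (old v _) = v ∈ T
  lift T (ray v _ _) = v ∈ T
  lift T center = ⊥
  lift T (sub _ _ _ _) = ⊥

-- On the component C, a proper 2-colouring of G is determined by one bit k: it equals the
-- fixed colouring col, or its complement, according to k. In G' the same bit is the colour of
-- the centre, and it forces the colour of every ray v to be col v xor k: a white ray is
-- adjacent to the centre, a black ray is joined to it by a path of length two. So a proper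
-- colouring of G and one of G' can be exchanged by trading the colouring of C for that of the
-- star, and on S the two colourings agree. Building a colouring of G from one of G' requires
-- deciding membership in C, which breadth-first search does.
module Submission where

open import Data.Bool using (Bool; true; false; not; _xor_)
open import Data.Bool.Properties
  using (¬-not; not-¬; not-involutive; not-distribˡ-xor; xor-assoc; xor-same)
  renaming (_≟_ to _≟ᵇ_)
open import Data.Fin using (Fin; _≟_)
open import Data.Fin.Properties using (any?)
open import Data.Fin.Subset using (Subset; _∈_; _⊆_; _⊂_; ⁅_⁆; ∣_∣)
open import Data.Fin.Subset.Properties
  using (_∈?_; _⊂?_; x∈⁅x⁆; x∈⁅y⁆⇒x≡y; ∣⁅x⁆∣≡1; ∣p∣≤n; p⊂q⇒∣p∣<∣q∣)
open import Data.Nat using (ℕ; zero; suc; _<_; s≤s)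
open import Data.Nat.Properties using (≤-reflexive; ≤-trans; <⇒≱)
open import Data.Product using (∃; _×_; _,_)
open import Data.Sum using (_⊎_; inj₁; inj₂)
open import Data.Vec using (tabulate)
open import Data.Vec.Properties using ([]=⇒lookup; lookup⇒[]=; lookup∘tabulate)
open import Function using (_∘_)
open import Function.Bundles using (_⇔_; mk⇔)
open import Relation.Nullary using (¬_; Dec; yes; no; does; contradiction)
open import Relation.Nullary.Decidable
  using (_×-dec_; _⊎-dec_; map′; decidable-stable; dec-true; isYes≗does)
open import Relation.Unary using (Decidable)
open import Relation.Binary.PropositionalEquality
  using (_≡_; _≢_; refl; sym; trans; cong; ≢-sym; module ≡-Reasoning)

open import Defs

module _ {n : ℕ} {P : Fin n → Set} (P? : Decidable P) where

  subset : Subset n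
  subset = tabulate (does ∘ P?)

  ∈-subset⁻ : ∀ {v} → v ∈ subset → P v
  ∈-subset⁻ {v} v∈ with P? v | trans (sym (lookup∘tabulate (does ∘ P?) v)) ([]=⇒lookup v∈)
  ... | yes p | _  = p
  ... | no _  | ()

  ∈-subset⁺ : ∀ {v} → P v → v ∈ subset
  ∈-subset⁺ {v} p = lookup⇒[]= v subset (trans (lookup∘tabulate (does ∘ P?) v) (dec-true (P? v) p))

module Reachability {n : ℕ} (adj : Fin n → Fin n → Bool) (a : Fin n) where

  Closed : Subset n → Set
  Closed p = ∀ {u v} → u ∈ p → adj u v ≡ true → v ∈ p

  Expand : Subset n → Fin n → Set
  Expand p v = v ∈ p ⊎ ∃ λ u → u ∈ p × adj u v ≡ true

  expand? : ∀ p → Decidable (Expand p)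
  expand? p v = (v ∈? p) ⊎-dec any? (λ u → (u ∈? p) ×-dec (adj u v ≟ᵇ true))

  ball : ℕ → Subset n
  ball zero    = ⁅ a ⁆
  ball (suc k) = subset (expand? (ball k))

  ball-⊆-suc : ∀ k → ball k ⊆ ball (suc k)
  ball-⊆-suc k v∈ = ∈-subset⁺ (expand? (ball k)) (inj₁ v∈)

  adj-∈-ball-suc : ∀ k {u v} → u ∈ ball k → adj u v ≡ true → v ∈ ball (suc k)
  adj-∈-ball-suc k {u} u∈ e = ∈-subset⁺ (expand? (ball k)) (inj₂ (u , u∈ , e))

  a∈ball : ∀ k → a ∈ ball k
  a∈ball zero    = x∈⁅x⁆ a
  a∈ball (suc k) = ball-⊆-suc k (a∈ball k)

  ∈-ball⇒reach : ∀ k {v} → v ∈ ball k → Reach adj a v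
  ∈-ball⇒reach zero v∈ with x∈⁅y⁆⇒x≡y a v∈
  ... | refl = here
  ∈-ball⇒reach (suc k) v∈ with ∈-subset⁻ (expand? (ball k)) v∈
  ... | inj₁ v∈'           = ∈-ball⇒reach k v∈'
  ... | inj₂ (u , u∈ , e) = step (∈-ball⇒reach k u∈) e

  closed⇒ball-suc-⊆ : ∀ k → Closed (ball k) → ball (suc k) ⊆ ball k
  closed⇒ball-suc-⊆ k closed v∈ with ∈-subset⁻ (expand? (ball k)) v∈
  ... | inj₁ v∈'           = v∈'
  ... | inj₂ (u , u∈ , e) = closed u∈ e

  closed⇒closed-suc : ∀ k → Closed (ball k) → Closed (ball (suc k))
  closed⇒closed-suc k closed u∈ e = ball-⊆-suc k (closed (closed⇒ball-suc-⊆ k closed u∈) e)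

  grows-or-closed : ∀ k → ball k ⊂ ball (suc k) ⊎ Closed (ball k)
  grows-or-closed k with ball k ⊂? ball (suc k)
  ... | yes ⊂ = inj₁ ⊂
  ... | no ¬⊂ = inj₂ λ {_} {v} u∈ e → decidable-stable (v ∈? ball k) λ v∉ →
                  ¬⊂ (ball-⊆-suc k , v , adj-∈-ball-suc k u∈ e , v∉)

  closed-or-large : ∀ k → Closed (ball k) ⊎ k < ∣ ball k ∣
  closed-or-large zero = inj₂ (≤-reflexive (sym (∣⁅x⁆∣≡1 a)))
  closed-or-large (suc k) with closed-or-large k
  ... | inj₁ closed = inj₁ (closed⇒closed-suc k closed)
  ... | inj₂ large with grows-or-closed k
  ...   | inj₁ ⊂      = inj₂ (≤-trans (s≤s large) (p⊂q⇒∣p∣<∣q∣ ⊂))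
  ...   | inj₂ closed = inj₁ (closed⇒closed-suc k closed)

  ball-n-closed : Closed (ball n)
  ball-n-closed with closed-or-large n
  ... | inj₁ closed = closed
  ... | inj₂ large  = contradiction (∣p∣≤n (ball n)) (<⇒≱ large)

  reach⇒∈ball : ∀ {v} → Reach adj a v → v ∈ ball n
  reach⇒∈ball here       = a∈ball n
  reach⇒∈ball (step r e) = ball-n-closed (reach⇒∈ball r) e

  reach? : Decidable (Reach adj a)
  reach? v = map′ (∈-ball⇒reach n) reach⇒∈ball (v ∈? ball n)

xor-cancelʳ : ∀ k {a b} → a xor k ≡ b xor k → a ≡ b
xor-cancelʳ k {false} {false} _ = refl
xor-cancelʳ k {true}  {true}  _ = refl
xor-cancelʳ k {false} {true}  e = contradiction e (not-¬ refl)
xor-cancelʳ k {true}  {false} e = contradiction (sym e) (not-¬ refl)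

module StarReduction (n : ℕ) (adj : Fin n → Fin n → Bool)
    (adj-sym : ∀ u v → adj u v ≡ adj v u)
    (S : Subset n) (c₀ : Fin n) (col : Fin n → Bool)
    (col-proper : ∀ u v → Reach adj c₀ u → adj u v ≡ true → col u ≢ col v) where

  open Star n adj S c₀ col
  open Reachability adj c₀ using (reach?)

  proper⇒≡col-xor : ∀ {c} → Proper adj c → ∀ {v} → C v → c v ≡ col v xor (col c₀ xor c c₀)
  proper⇒≡col-xor {c} c-proper here = begin
    c c₀                             ≡⟨⟩
    false xor c c₀                   ≡⟨ cong (_xor c c₀) (sym (xor-same (col c₀))) ⟩
    (col c₀ xor col c₀) xor c c₀     ≡⟨ xor-assoc (col c₀) (col c₀) (c c₀) ⟩
    col c₀ xor (col c₀ xor c c₀)     ∎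
    where
    open ≡-Reasoning
  proper⇒≡col-xor {c} c-proper (step {u} {v} r e) = begin
    c v                ≡⟨ ¬-not (≢-sym (c-proper u v e)) ⟩
    not (c u)          ≡⟨ cong not (proper⇒≡col-xor c-proper r) ⟩
    not (col u xor k)  ≡⟨ not-distribˡ-xor (col u) k ⟩
    not (col u) xor k  ≡⟨ cong (_xor k) (sym (¬-not (≢-sym (col-proper u v r e)))) ⟩
    col v xor k        ∎
    where
    open ≡-Reasoning
    k : Bool
    k = col c₀ xor c c₀

  module Extend (c : Fin n → Bool) (c-proper : Proper adj c) where

    k : Bool
    k = col c₀ xor c c₀

    c' : V' → Bool
    c' (old v _)       = c v
    c' (ray v _ _)     = c v
    c' center          = k
    c' (sub _ _ _ _)   = not k

    white-ray : ∀ {v} → C v → col v ≡ true → c v ≢ k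
    white-ray r white cv≡k =
      not-¬ refl (trans (sym cv≡k) (trans (proper⇒≡col-xor c-proper r) (cong (_xor k) white)))

    black-ray : ∀ {v} → C v → col v ≡ false → c v ≢ not k
    black-ray r black =
      not-¬ (trans (proper⇒≡col-xor c-proper r) (cong (_xor k) black))

    c'-proper : Proper adj' c'
    c'-proper (old u _)     (old v _)       e = c-proper u v e
    c'-proper (ray _ r _)   center          e = white-ray r e
    c'-proper center        (ray _ r _)     e = ≢-sym (white-ray r e)
    c'-proper (ray v r _)   (sub w _ _ b)   e with v ≟ w
    ... | yes refl = black-ray r b
    c'-proper (ray v r _)   (sub w _ _ b)   () | no _
    c'-proper (sub w _ _ b) (ray v r _)     e with v ≟ w
    ... | yes refl = ≢-sym (black-ray r b)
    c'-proper (sub w _ _ b) (ray v r _)     () | no _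
    c'-proper center        (sub _ _ _ _)   e = not-¬ refl
    c'-proper (sub _ _ _ _) center          e = ≢-sym (not-¬ refl)
    c'-proper (old _ _)     (ray _ _ _)     ()
    c'-proper (old _ _)     center          ()
    c'-proper (old _ _)     (sub _ _ _ _)   ()
    c'-proper (ray _ _ _)   (old _ _)       ()
    c'-proper (ray _ _ _)   (ray _ _ _)     ()
    c'-proper center        (old _ _)       ()
    c'-proper center        center          ()
    c'-proper (sub _ _ _ _) (old _ _)       ()
    c'-proper (sub _ _ _ _) (sub _ _ _ _)   ()

  module Restrict (c' : V' → Bool) (c'-proper : Proper adj' c') where

    k : Bool
    k = c' center

    ray-colour : ∀ {v} (r : C v) (s : v ∈ S) → c' (ray v r s) ≡ col v xor k
    ray-colour {v} r s with col v in colour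
    ... | true  = ¬-not (c'-proper (ray v r s) center colour)
    ... | false = begin
      c' (ray v r s)              ≡⟨ ¬-not (c'-proper (ray v r s) (sub v r s colour) v∼sub) ⟩
      not (c' (sub v r s colour)) ≡⟨ cong not (¬-not (c'-proper (sub v r s colour) center refl)) ⟩
      not (not k)                 ≡⟨ not-involutive k ⟩
      k                           ∎
      where
      open ≡-Reasoning
      v∼sub : adj' (ray v r s) (sub v r s colour) ≡ true
      v∼sub = trans (isYes≗does (v ≟ v)) (dec-true (v ≟ v) refl)

    colourAt : ∀ v → Dec (C v) → Bool
    colourAt v (yes _) = col v xor k
    colourAt v (no p)  = c' (old v p)

    c : Fin n → Bool
    c v = colourAt v (reach? v)

    c-proper : Proper adj c
    c-proper u v e = colourAt-proper (reach? u) (reach? v)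
      where
      colourAt-proper : ∀ du dv → colourAt u du ≢ colourAt v dv
      colourAt-proper (yes r) (yes _) = col-proper u v r e ∘ xor-cancelʳ k
      colourAt-proper (yes r) (no q)  = contradiction (step r e) q
      colourAt-proper (no p)  (yes r) = contradiction (step r (trans (adj-sym v u) e)) p
      colourAt-proper (no p)  (no q)  = c'-proper (old u p) (old v q) e

  to-star : ∀ S' → InB adj (_∈ S) (_∈ S') → InB adj' (lift S) (lift S')
  to-star S' (c , b , c-proper , same , other) = c' , b , c'-proper , same' , other'
    where
    open Extend c c-proper
    same' : ∀ x → lift S x → lift S' x → c' x ≡ b
    same' (old v _)   = same v
    same' (ray v _ _) = same v
    other' : ∀ x → lift S x → ¬ lift S' x → c' x ≡ not b
    other' (old v _)   = other v
    other' (ray v _ _) = other v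

  from-star : ∀ S' → InB adj' (lift S) (lift S') → InB adj (_∈ S) (_∈ S')
  from-star S' (c' , b , c'-proper , same , other) = c , b , c-proper , same' , other'
    where
    open Restrict c' c'-proper
    same' : ∀ v → v ∈ S → v ∈ S' → c v ≡ b
    same' v s s' = colourAt-same (reach? v)
      where
      colourAt-same : ∀ d → colourAt v d ≡ b
      colourAt-same (yes r) = trans (sym (ray-colour r s)) (same (ray v r s) s s')
      colourAt-same (no p)  = same (old v p) s s'
    other' : ∀ v → v ∈ S → ¬ v ∈ S' → c v ≡ not b
    other' v s s' = colourAt-other (reach? v)
      where
      colourAt-other : ∀ d → colourAt v d ≡ not b
      colourAt-other (yes r) = trans (sym (ray-colour r s)) (other (ray v r s) s s')
      colourAt-other (no p)  = other (old v p) s s'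

lemma3 : (n : ℕ) (adj : Fin n → Fin n → Bool)
    → (∀ u v → adj u v ≡ adj v u)
    → (∀ v → adj v v ≡ false)
    → (S : Subset n) (c₀ : Fin n) (col : Fin n → Bool)
    → (∀ u v → Reach adj c₀ u → adj u v ≡ true → col u ≢ col v)
    → (S' : Subset n) → S' ⊆ S
    → InB adj (_∈ S) (_∈ S') ⇔ InB (Star.adj' n adj S c₀ col) (Star.lift n adj S c₀ col S) (Star.lift n adj S c₀ col S')
lemma3 n adj adj-sym _ S c₀ col col-proper S' _ = mk⇔ (to-star S') (from-star S')
  where open StarReduction n adj adj-sym S c₀ col col-proper
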